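{- Let $\Phi$ be a formula with $k$ free nodes, with truth table $h:\{T,F,L,V\}^k\to\{T,F,L,V\}$ and restricted truth table $g:\{T,F\}^k\to\{T,F,L,V\}$. Let $(\epsilon_1,\dots,\epsilon_k)\in\{T,F,L,V\}^k$, and let $\mathcal L=\{i:\epsilon_i=L\}$, $\mathcal V=\{i:\epsilon_i=V\}$. Then, with respect to the partial order $\preceq$, $$h(\epsilon_1,\dots,\epsilon_k)\ \succeq\ \inf_{(\mu_i)_{i\in\mathcal V}\in\{T,F\}^{\mathcal V}}\ \sup_{(\mu_i)_{i\in\mathcal L}\in\{T,F\}^{\mathcal L}}\ g(\mu_1,\dots,\mu_k),$$ where in $g(\mu_1,\dots,\mu_k)$ one sets $\mu_i=\epsilon_i$ whenever $\epsilon_i\in\{T,F\}$.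
   Context: $\preceq$ is the partial order on $\{T,F,L,V\}$ with $V\prec T\prec L$ and $V\prec F\prec L$, and $T,F$ incomparable (so $V$ is least, $L$ greatest; infima and suprema refer to this lattice). A labelled $k$-ary boolean operator ($k\ge 0$) is a pair $(p,\gamma)$ with $p$ a label and $\gamma:\{t,f\}^k\to\{t,f\}$; operators with different labels are different nodes. A formula is a triple $\Phi=(G,n^*,F)$ where $G$ is a finite directed graph whose nodes are labelled boolean operators and propositional letters, such that every node with $k>0$ children is a $k$-ary boolean operator and every node with no children is a constant operator or a propositional letter; the children of each node are distinct and linearly ordered, cycles are allowed (a node may be its own child), and each propositional letter occurs at most once; $n^*$ is a distinguished node and $F$ is a set of nodes called free. An evaluation is a function $e:F\to\{T,F,V,L\}$; a free node $c$ with $e(c)=P$ is bound as $P$, non-free nodes are unbound. A hypothesis is a function $H$ from the nodes to $\{t,f\}$. A hypothesis $K$ is an elementary consequence of $H$ if there is a single node $c$ with $K(c)=\neg H(c)$ and $K=H$ elsewhere, and one of: (1) $c$ bound as $T$ and $H(c)=f$; (2) $c$ bound as $F$ and $H(c)=t$; (3) $c$ bound as $L$; (4) $c$ unbound, with children $c_1,\dots,c_n$ ($n\ge1$) and operator $\gamma_c$, and there are a nonempty $I\subseteq\{1,\dots,n\}$ and $x\in\{t,f\}^n$ with $x_i=H(c_i)$ for $i\in I$ and $\gamma_c(x)=\neg H(c)$; (5) $c$ unbound and there are a node $d$ with children $d_1,\dots,d_m$ and operator $\gamma_d$, an index $j$ with $d_j=c$, a set $I\subseteq\{1,\dots,m\}$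 containing $j$, and $x\in\{t,f\}^m$ with $x_j=\neg H(c)$, $x_i=H(d_i)$ for $i\in I\setminus\{j\}$, and $\gamma_d(x)=H(d)$. $K$ is a consequence of $H$ if obtained by a finite sequence of elementary consequences. A proposition $(\Phi,e)$ can get stuck in $t$ (resp. $f$) if some hypothesis $H$ with $H(n^*)=t$ (resp. $f$) has no consequence $K$ with $K(n^*)=f$ (resp. $t$). Its truth value is $T$ if it can get stuck in $t$ but not in $f$; $F$ if in $f$ but not in $t$; $V$ if in both; $L$ if in neither. For free nodes ordered $n_1,\dots,n_k$, the truth table sends $(e(n_1),\dots,e(n_k))$ to the truth value of $(\Phi,e)$; the restricted truth table is its restriction to $\{T,F\}^k$. -}

module Defs where

open import Data.Nat using (ℕ; zero; suc)
open import Data.Fin using (Fin; zero; suc)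
open import Data.Bool using (Bool; true; false; not)
open import Data.Vec using (Vec; []; _∷_; lookup)
open import Data.List using (List; []; _∷_; map; concatMap; foldr)
open import Data.Product using (Σ; _×_; _,_)
open import Data.Sum using (_⊎_)
open import Data.Empty using (⊥)
open import Relation.Nullary using (¬_)
open import Relation.Binary.PropositionalEquality using (_≡_; _≢_)
open import Relation.Binary.Construct.Closure.ReflexiveTransitive using (Star)

data TV : Set where
  T F L V : TV

data _≼_ : TV → TV → Set where
  refl≼ : ∀ {x} → x ≼ x
  V≼    : ∀ {x} → V ≼ x
  ≼L    : ∀ {x} → x ≼ L

_⊓_ : TV → TV → TV
L ⊓ y = y
V ⊓ y = V
T ⊓ T = T
T ⊓ F = V
T ⊓ L = T
T ⊓ V = V
F ⊓ T = V
F ⊓ F = F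
F ⊓ L = F
F ⊓ V = V

_⊔_ : TV → TV → TV
V ⊔ y = y
L ⊔ y = L
T ⊔ T = T
T ⊔ F = L
T ⊔ L = L
T ⊔ V = T
F ⊔ T = L
F ⊔ F = F
F ⊔ L = L
F ⊔ V = F

Inf : List TV → TV
Inf = foldr _⊓_ L

Sup : List TV → TV
Sup = foldr _⊔_ V

-- A node with n children is either an n-ary boolean operator, or
-- (only when n = 0) a propositional letter.  (0-ary operators are constants.)
data NodeKind : ℕ → Set where
  op     : ∀ {n} → (Vec Bool n → Bool) → NodeKind n
  letter : NodeKind 0

-- A formula with k free nodes (listed in order free 0, …, free (k-1)).
-- Nodes are Fin N, hence pairwise distinct (distinct labels / letters).
record Formula (k : ℕ) : Set where
  field
    N        : ℕ
    arity    : Fin N → ℕ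
    kind     : (c : Fin N) → NodeKind (arity c)
    children : (c : Fin N) → Vec (Fin N) (arity c)
    children-distinct : ∀ c i j → lookup (children c) i ≡ lookup (children c) j → i ≡ j
    root     : Fin N
    free     : Fin k → Fin N
    free-injective : ∀ i j → free i ≡ free j → i ≡ j

module _ {k : ℕ} (Φ : Formula k) (e : Vec TV k) where
  open Formula Φ

  Hypothesis : Set
  Hypothesis = Fin N → Bool

  BoundAs : Fin N → TV → Set
  BoundAs c P = Σ (Fin k) λ i → free i ≡ c × lookup e i ≡ P

  Unbound : Fin N → Set
  Unbound c = ∀ i → free i ≢ c

  FlipAt : Hypothesis → Hypothesis → Fin N → Set
  FlipAt H K c = K c ≡ not (H c) × (∀ d → d ≢ c → K d ≡ H d)

  Rule4 : Hypothesis → Fin N → Set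
  Rule4 H c =
    Unbound c ×
    Σ (Vec Bool (arity c) → Bool) λ γ → kind c ≡ op γ ×
    Σ (Fin (arity c) → Bool) λ I → Σ (Fin (arity c)) (λ i₀ → I i₀ ≡ true) ×
    Σ (Vec Bool (arity c)) λ x →
      (∀ i → I i ≡ true → lookup x i ≡ H (lookup (children c) i)) ×
      γ x ≡ not (H c)

  Rule5 : Hypothesis → Fin N → Set
  Rule5 H c =
    Unbound c ×
    Σ (Fin N) λ d →
    Σ (Vec Bool (arity d) → Bool) λ γ → kind d ≡ op γ ×
    Σ (Fin (arity d)) λ j → lookup (children d) j ≡ c ×
    Σ (Fin (arity d) → Bool) λ I → I j ≡ true ×
    Σ (Vec Bool (arity d)) λ x →
      lookup x j ≡ not (H c) ×
      (∀ i → I i ≡ true → i ≢ j → lookup x i ≡ H (lookup (children d) i)) ×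
      γ x ≡ H d

  Reason : Hypothesis → Fin N → Set
  Reason H c =
      (BoundAs c T × H c ≡ false)
    ⊎ (BoundAs c F × H c ≡ true)
    ⊎ BoundAs c L
    ⊎ Rule4 H c
    ⊎ Rule5 H c

  ElementaryConsequence : Hypothesis → Hypothesis → Set
  ElementaryConsequence H K = Σ (Fin N) λ c → FlipAt H K c × Reason H c

  Consequence : Hypothesis → Hypothesis → Set
  Consequence = Star ElementaryConsequence

  CanGetStuckIn : Bool → Set
  CanGetStuckIn b =
    Σ Hypothesis λ H → H root ≡ b ×
      ¬ (Σ Hypothesis λ K → Consequence H K × K root ≡ not b)

  IsTruthValue : TV → Set
  IsTruthValue T = CanGetStuckIn true × ¬ CanGetStuckIn false
  IsTruthValue F = ¬ CanGetStuckIn true × CanGetStuckIn false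
  IsTruthValue V = CanGetStuckIn true × CanGetStuckIn false
  IsTruthValue L = ¬ CanGetStuckIn true × ¬ CanGetStuckIn false

toTV : Bool → TV
toTV true  = T
toTV false = F

toTVs : ∀ {k} → Vec Bool k → Vec TV k
toTVs []       = []
toTVs (b ∷ bs) = toTV b ∷ toTVs bs

IsTruthTable : ∀ {k} → Formula k → (Vec TV k → TV) → Set
IsTruthTable Φ h = ∀ e → IsTruthValue Φ e (h e)

IsRestrictedTruthTable : ∀ {k} → Formula k → (Vec Bool k → TV) → Set
IsRestrictedTruthTable Φ g = ∀ μ → IsTruthValue Φ (toTVs μ) (g μ)

isV isL : TV → Bool
isV V = true
isV _ = false
isL L = true
isL _ = false

-- enumerate {T,F}^S for S = {i : P i} as vectors in Vec Bool k whose
-- coordinates outside S are fixed to false (a bijection with {T,F}^S)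
Choices : ∀ {k} → Vec Bool k → List (Vec Bool k)
Choices [] = [] ∷ []
Choices (true ∷ P)  = concatMap (λ v → (true ∷ v) ∷ (false ∷ v) ∷ []) (Choices P)
Choices (false ∷ P) = map (false ∷_) (Choices P)

combine : ∀ {k} → Vec TV k → Vec Bool k → Vec Bool k → Vec Bool k
combine []      []        []        = []
combine (T ∷ ε) (_ ∷ μV)  (_ ∷ μL)  = true  ∷ combine ε μV μL
combine (F ∷ ε) (_ ∷ μV)  (_ ∷ μL)  = false ∷ combine ε μV μL
combine (V ∷ ε) (b ∷ μV)  (_ ∷ μL)  = b     ∷ combine ε μV μL
combine (L ∷ ε) (_ ∷ μV)  (b ∷ μL)  = b     ∷ combine ε μV μL

mapV : ∀ {k} → (TV → Bool) → Vec TV k → Vec Bool k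
mapV f []      = []
mapV f (x ∷ xs) = f x ∷ mapV f xs

InfSupBound : ∀ {k} → (Vec Bool k → TV) → Vec TV k → TV
InfSupBound g ε =
  Inf (map (λ μV → Sup (map (λ μL → g (combine ε μV μL)) (Choices (mapV isL ε))))
           (Choices (mapV isV ε)))

-- A truth value lies below the coatom T (resp. F) of ≼ exactly when a proposition
-- with that value can get stuck in t (resp. f).  So suppose (Φ, ε) gets stuck in b
-- at a hypothesis H₀, and let μ read the V-nodes off H₀ and choose the L-nodes
-- arbitrarily.  Every consequence of H₀ under μ is one under ε: an L-node may flip
-- under ε anyway, and a V-node never flips under ε, nor, while it still holds its
-- H₀-value, under μ.  Hence (Φ, μ) is stuck in b too, so g(μ) ≼ toTV b for all
-- choices on ℒ, and the infimum over 𝒱 lies below their supremum.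
module Submission where

open import Defs
open import Data.Nat using (ℕ)
open import Data.Bool using (Bool; true; false; not; _∧_)
open import Data.Fin using (Fin; zero; suc; _≟_)
open import Data.Vec using (Vec; []; _∷_; lookup; tabulate)
open import Data.List using (List; []; _∷_; map)
open import Data.List.Membership.Propositional using (_∈_)
open import Data.List.Membership.Propositional.Properties using (∈-map⁺; ∈-concatMap⁺)
open import Data.List.Relation.Unary.Any as Any using (here; there)
open import Data.Product using (Σ; _×_; _,_)
open import Data.Sum using (_⊎_; inj₁; inj₂)
open import Data.Unit using (⊤; tt)
open import Data.Empty using (⊥; ⊥-elim)
open import Function using (_∘_)
open import Relation.Nullary using (¬_; yes; no)
open import Relation.Binary.PropositionalEquality using (_≡_; refl; sym; trans; cong; subst)
open import Relation.Binary.Construct.Closure.ReflexiveTransitive as Star using (_◅_)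

≼-trans : ∀ {x y z} → x ≼ y → y ≼ z → x ≼ z
≼-trans refl≼ q     = q
≼-trans V≼    q     = V≼
≼-trans ≼L    refl≼ = ≼L
≼-trans ≼L    ≼L    = ≼L

≼-fromCoatoms : ∀ {x y} → (∀ b → y ≼ toTV b → x ≼ toTV b) → x ≼ y
≼-fromCoatoms {y = T} below = below true refl≼
≼-fromCoatoms {y = F} below = below false refl≼
≼-fromCoatoms {y = L} below = ≼L
≼-fromCoatoms {y = V} below = ≼-glb (below true V≼) (below false V≼)
  where
  ≼-glb : ∀ {x} → x ≼ T → x ≼ F → x ≼ V
  ≼-glb V≼ _ = V≼

x⊓y≼x : ∀ x y → (x ⊓ y) ≼ x
x⊓y≼x L y = ≼L
x⊓y≼x V y = V≼
x⊓y≼x T T = refl≼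
x⊓y≼x T F = V≼
x⊓y≼x T L = refl≼
x⊓y≼x T V = V≼
x⊓y≼x F T = V≼
x⊓y≼x F F = refl≼
x⊓y≼x F L = refl≼
x⊓y≼x F V = V≼

x⊓y≼y : ∀ x y → (x ⊓ y) ≼ y
x⊓y≼y L y = refl≼
x⊓y≼y V y = V≼
x⊓y≼y T T = refl≼
x⊓y≼y T F = V≼
x⊓y≼y T L = ≼L
x⊓y≼y T V = V≼
x⊓y≼y F T = V≼
x⊓y≼y F F = refl≼
x⊓y≼y F L = ≼L
x⊓y≼y F V = V≼

⊔-lub : ∀ {x y z} → x ≼ z → y ≼ z → (x ⊔ y) ≼ z
⊔-lub {V} _     q     = q
⊔-lub {L} p     _     = p
⊔-lub     ≼L    q     = ≼L
⊔-lub {T} refl≼ refl≼ = refl≼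
⊔-lub {T} refl≼ V≼    = refl≼
⊔-lub {F} refl≼ refl≼ = refl≼
⊔-lub {F} refl≼ V≼    = refl≼

Inf-map-lower : ∀ {A : Set} (f : A → TV) {a xs} → a ∈ xs → Inf (map f xs) ≼ f a
Inf-map-lower f {xs = x ∷ xs} (here refl) = x⊓y≼x (f x) (Inf (map f xs))
Inf-map-lower f {xs = x ∷ xs} (there a∈xs) =
  ≼-trans (x⊓y≼y (f x) (Inf (map f xs))) (Inf-map-lower f a∈xs)

Sup-map-lub : ∀ {A : Set} (f : A → TV) {z} (xs : List A) → (∀ a → f a ≼ z) → Sup (map f xs) ≼ z
Sup-map-lub f []       below = V≼
Sup-map-lub f (x ∷ xs) below = ⊔-lub (below x) (Sup-map-lub f xs below)

module _ {k} {Φ : Formula k} {e : Vec TV k} where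

  ≼-coatom⇒stuck : ∀ {v b} → IsTruthValue Φ e v → v ≼ toTV b → CanGetStuckIn Φ e b
  ≼-coatom⇒stuck {T} {true}  (stuck , _) refl≼ = stuck
  ≼-coatom⇒stuck {F} {false} (_ , stuck) refl≼ = stuck
  ≼-coatom⇒stuck {V} {true}  (stuck , _) V≼    = stuck
  ≼-coatom⇒stuck {V} {false} (_ , stuck) V≼    = stuck

  stuck⇒≼-coatom : ∀ {v b} → IsTruthValue Φ e v → CanGetStuckIn Φ e b → v ≼ toTV b
  stuck⇒≼-coatom {T} {true}  _            _     = refl≼
  stuck⇒≼-coatom {T} {false} (_ , ¬stuck) stuck = ⊥-elim (¬stuck stuck)
  stuck⇒≼-coatom {F} {true}  (¬stuck , _) stuck = ⊥-elim (¬stuck stuck)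
  stuck⇒≼-coatom {F} {false} _            _     = refl≼
  stuck⇒≼-coatom {V}         _            _     = V≼
  stuck⇒≼-coatom {L} {true}  (¬stuck , _) stuck = ⊥-elim (¬stuck stuck)
  stuck⇒≼-coatom {L} {false} (_ , ¬stuck) stuck = ⊥-elim (¬stuck stuck)

Flippable : TV → Bool → Set
Flippable T b = b ≡ false
Flippable F b = b ≡ true
Flippable L _ = ⊤
Flippable V _ = ⊥

module _ {k} (Φ : Formula k) (e : Vec TV k) where
  open Formula Φ

  BoundReason : Hypothesis Φ e → Fin N → Set
  BoundReason H c = Σ TV λ P → BoundAs Φ e c P × Flippable P (H c)

  reason-split : ∀ {H c} → Reason Φ e H c → BoundReason H c ⊎ (Rule4 Φ e H c ⊎ Rule5 Φ e H c)
  reason-split (inj₁ (bound , flip))             = inj₁ (T , bound , flip)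
  reason-split (inj₂ (inj₁ (bound , flip)))      = inj₁ (F , bound , flip)
  reason-split (inj₂ (inj₂ (inj₁ bound)))        = inj₁ (L , bound , tt)
  reason-split (inj₂ (inj₂ (inj₂ (inj₁ rule4)))) = inj₂ (inj₁ rule4)
  reason-split (inj₂ (inj₂ (inj₂ (inj₂ rule5)))) = inj₂ (inj₂ rule5)

  boundReason⇒reason : ∀ {H c} → BoundReason H c → Reason Φ e H c
  boundReason⇒reason (T , bound , flip) = inj₁ (bound , flip)
  boundReason⇒reason (F , bound , flip) = inj₂ (inj₁ (bound , flip))
  boundReason⇒reason (L , bound , _)    = inj₂ (inj₂ (inj₁ bound))

  boundAs-unique : ∀ {c P Q} → BoundAs Φ e c P → BoundAs Φ e c Q → P ≡ Q
  boundAs-unique (i , refl , refl) (j , fj≡fi , refl) = cong (lookup e) (free-injective i j (sym fj≡fi))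

  boundAsV-frozen : ∀ {H c} → BoundAs Φ e c V → ¬ Reason Φ e H c
  boundAsV-frozen {H} {c} boundV@(i , fi≡c , _) r with reason-split r
  ... | inj₁ (P , bound , flip)   = subst (λ Q → Flippable Q (H c)) (boundAs-unique bound boundV) flip
  ... | inj₂ (inj₁ (unbound , _)) = unbound i fi≡c
  ... | inj₂ (inj₂ (unbound , _)) = unbound i fi≡c

Sharpens : Bool → TV → TV → Set
Sharpens _ T y = y ≡ T
Sharpens _ F y = y ≡ F
Sharpens b V y = y ≡ toTV b
Sharpens _ L _ = ⊤

toTV-unflippable : ∀ b → ¬ Flippable (toTV b) b
toTV-unflippable true  ()
toTV-unflippable false ()

flippable-sharpen : ∀ {b} x {y c} → Sharpens b x y → Flippable y c → (x ≡ V → c ≡ b) → Flippable x c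
flippable-sharpen T     refl flip _      = flip
flippable-sharpen F     refl flip _      = flip
flippable-sharpen L     _    _    _      = tt
flippable-sharpen {b} V refl flip frozen =
  ⊥-elim (toTV-unflippable b (subst (Flippable (toTV b)) (frozen refl) flip))

module Sharpening {k} (Φ : Formula k) (ε e : Vec TV k) (H₀ : Fin (Formula.N Φ) → Bool)
                  (sharp : ∀ i → Sharpens (H₀ (Formula.free Φ i)) (lookup ε i) (lookup e i)) where
  open Formula Φ

  AgreesOnV : (Fin N → Bool) → Set
  AgreesOnV K = ∀ i → lookup ε i ≡ V → K (free i) ≡ H₀ (free i)

  reason-sharpen : ∀ {K c} → AgreesOnV K → Reason Φ e K c → Reason Φ ε K c
  reason-sharpen agree r with reason-split Φ e r
  ... | inj₁ (_ , (i , refl , eᵢ≡P) , flip) =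
    boundReason⇒reason Φ ε (lookup ε i , (i , refl , refl) ,
      flippable-sharpen (lookup ε i) (subst (Sharpens _ _) eᵢ≡P (sharp i)) flip (agree i))
  ... | inj₂ (inj₁ rule4) = inj₂ (inj₂ (inj₂ (inj₁ rule4)))
  ... | inj₂ (inj₂ rule5) = inj₂ (inj₂ (inj₂ (inj₂ rule5)))

  elementary-sharpen : ∀ {K K′} → AgreesOnV K → ElementaryConsequence Φ e K K′ → ElementaryConsequence Φ ε K K′
  elementary-sharpen agree (c , flip , r) = c , flip , reason-sharpen agree r

  agreesOnV-preserved : ∀ {K K′} → AgreesOnV K → ElementaryConsequence Φ ε K K′ → AgreesOnV K′
  agreesOnV-preserved agree (c , (_ , unchanged) , r) i εᵢ≡V with free i ≟ c
  ... | no  fᵢ≢c = trans (unchanged (free i) fᵢ≢c) (agree i εᵢ≡V)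
  ... | yes refl = ⊥-elim (boundAsV-frozen Φ ε (i , refl , εᵢ≡V) r)

  consequence-sharpen : ∀ {K K′} → AgreesOnV K → Consequence Φ e K K′ → Consequence Φ ε K K′
  consequence-sharpen agree Star.ε        = Star.ε
  consequence-sharpen agree (step ◅ rest) =
    elementary-sharpen agree step ◅ consequence-sharpen (agreesOnV-preserved agree (elementary-sharpen agree step)) rest

  stuck-sharpen : ∀ {b} → H₀ root ≡ b → ¬ (Σ (Hypothesis Φ ε) λ K → Consequence Φ ε H₀ K × K root ≡ not b) →
                  CanGetStuckIn Φ e b
  stuck-sharpen H₀-root unescapable =
    H₀ , H₀-root , λ (K , H₀↝K , K-root) → unescapable (K , consequence-sharpen (λ _ _ → refl) H₀↝K , K-root)

mask : ∀ {k} → Vec Bool k → (Fin k → Bool) → Vec Bool k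
mask P f = tabulate (λ i → lookup P i ∧ f i)

mask-∈-Choices : ∀ {k} (P : Vec Bool k) (f : Fin k → Bool) → mask P f ∈ Choices P
mask-∈-Choices []          f = here refl
mask-∈-Choices (true ∷ P)  f =
  ∈-concatMap⁺ _ (Any.map (λ { refl → ∈-both (f zero) }) (mask-∈-Choices P (f ∘ suc)))
  where
  ∈-both : ∀ {n} b {v : Vec Bool n} → (b ∷ v) ∈ (true ∷ v) ∷ (false ∷ v) ∷ []
  ∈-both true  = here refl
  ∈-both false = there (here refl)
mask-∈-Choices (false ∷ P) f = ∈-map⁺ (false ∷_) (mask-∈-Choices P (f ∘ suc))

combine-sharpens : ∀ {k} (ε : Vec TV k) (f : Fin k → Bool) (μL : Vec Bool k) i →
                   Sharpens (f i) (lookup ε i) (lookup (toTVs (combine ε (mask (mapV isV ε) f) μL)) i)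
combine-sharpens (T ∷ ε) f (_ ∷ μL) zero    = refl
combine-sharpens (F ∷ ε) f (_ ∷ μL) zero    = refl
combine-sharpens (V ∷ ε) f (_ ∷ μL) zero    = refl
combine-sharpens (L ∷ ε) f (_ ∷ μL) zero    = tt
combine-sharpens (T ∷ ε) f (_ ∷ μL) (suc i) = combine-sharpens ε (f ∘ suc) μL i
combine-sharpens (F ∷ ε) f (_ ∷ μL) (suc i) = combine-sharpens ε (f ∘ suc) μL i
combine-sharpens (V ∷ ε) f (_ ∷ μL) (suc i) = combine-sharpens ε (f ∘ suc) μL i
combine-sharpens (L ∷ ε) f (_ ∷ μL) (suc i) = combine-sharpens ε (f ∘ suc) μL i

proposition3p7 : ∀ {k : ℕ} (Φ : Formula k) (h : Vec TV k → TV) (g : Vec Bool k → TV) →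
    IsTruthTable Φ h → IsRestrictedTruthTable Φ g →
    (ε : Vec TV k) → InfSupBound g ε ≼ h ε
proposition3p7 {k} Φ h g isTable isRestrictedTable ε =
  ≼-fromCoatoms λ b hε≼b → bound≼coatom (≼-coatom⇒stuck (isTable ε) hε≼b)
  where
  open Formula Φ
  bound≼coatom : ∀ {b} → CanGetStuckIn Φ ε b → InfSupBound g ε ≼ toTV b
  bound≼coatom (H₀ , H₀-root , unescapable) =
    ≼-trans (Inf-map-lower _ (mask-∈-Choices (mapV isV ε) (H₀ ∘ free)))
            (Sup-map-lub _ (Choices (mapV isL ε)) λ μL →
               stuck⇒≼-coatom (isRestrictedTable (μ μL))
                 (Sharpening.stuck-sharpen Φ ε (toTVs (μ μL)) H₀ (combine-sharpens ε (H₀ ∘ free) μL) H₀-root unescapable))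
    where
    μ : Vec Bool k → Vec Bool k
    μ = combine ε (mask (mapV isV ε) (H₀ ∘ free))
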